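{- Let $n\ge 1$ be an integer. Define polynomials $q_0,\dots,q_n$ by $q_0(x)=1$, $q_1(x)=x$ and $x\,q_j(x)=(j+1)\,q_{j+1}(x)+(n-j+1)\,q_{j-1}(x)$ for $1\le j\le n-1$. For $j\in[0,n]$ and $i\in[0,j]$ let $L_i(j)$ denote the coefficient of $x^{j-i}$ in $q_j(x)$. Then $$L_i(j)=\begin{cases}0,& i\text{ odd},\\[2pt] \dfrac{(-1)^{i/2}}{j!}\displaystyle\sum_{I\in\mathcal{I}(i/2,j)}R(I),& i\text{ even}.\end{cases}$$
   Context: A finite set of integers $\{u_1<\dots<u_k\}$ is called $2$-separated if $u_{l+1}-u_l\ge 2$ for all $l\in[k-1]$. For integers $k\ge0$ and $j$, $\mathcal{I}(k,j)$ denotes the set of all $k$-element subsets of $\{0,1,\dots,j-2\}$ that are $2$-separated (so $\mathcal{I}(0,j)=\{\emptyset\}$). For such $I$, $R(I)=\prod_{i\in I}(n-i)(i+1)$, with $R(\emptyset)=1$. -}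

module Defs where

open import Data.Nat using (ℕ; zero; suc; _∸_; _≡ᵇ_; _<ᵇ_)
open import Data.Integer as ℤ using (ℤ; +_)
open import Data.Rational as ℚ using (ℚ; 0ℚ; 1ℚ; _/_)
open import Data.Bool using (Bool; true; false; _∧_; if_then_else_)
open import Data.List using (List; []; _∷_; _++_; map; filterᵇ; length; foldr; [_]; _∷ʳ_)

-- A polynomial with rational coefficients, given by its coefficient
-- sequence: (p k) is the coefficient of x^k.
Poly : Set
Poly = ℕ → ℚ

one : Poly
one zero    = 1ℚ
one (suc _) = 0ℚ

X : Poly
X (suc zero) = 1ℚ
X _          = 0ℚ

mulX : Poly → Poly
mulX p zero    = 0ℚ
mulX p (suc k) = p k

_⊕_ : Poly → Poly → Poly
(p ⊕ r) k = p k ℚ.+ r k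

scale : ℚ → Poly → Poly
scale c p k = c ℚ.* p k

ℕ→ℚ : ℕ → ℚ
ℕ→ℚ m = (+ m) / 1

-- q n j : the polynomial q_j for parameter n, determined by
--   q_0 = 1, q_1 = x,
--   x q_{j} = (j+1) q_{j+1} + (n-j+1) q_{j-1}   (1 ≤ j ≤ n-1),
-- i.e. (with j = m+1)  q_{m+2} = (x q_{m+1} - (n-m) q_m) / (m+2).
-- (n - m is computed in ℚ, so no truncated subtraction is involved.)
q : ℕ → ℕ → Poly
q n zero                = one
q n (suc zero)          = X
q n (suc (suc m))       =
  scale ((+ 1) / suc (suc m))
        (mulX (q n (suc m)) ⊕ scale (ℚ.- (ℕ→ℚ n ℚ.- ℕ→ℚ m)) (q n m))

L : ℕ → ℕ → ℕ → ℚ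
L n i j = q n j (j ∸ i)

-- all subsets of {0,…,m-1}, each as a strictly increasing list
subsetsBelow : ℕ → List (List ℕ)
subsetsBelow zero    = [ [] ]
subsetsBelow (suc m) = subsetsBelow m ++ map (_∷ʳ m) (subsetsBelow m)

twoSep : List ℕ → Bool
twoSep []             = true
twoSep (_ ∷ [])       = true
twoSep (a ∷ b ∷ rest) = (suc a <ᵇ b) ∧ twoSep (b ∷ rest)

-- 𝓘(k , j): k-element 2-separated subsets of {0,…,j-2}
-- ({0,…,j-2} = subsets below j ∸ 1; empty for j ≤ 1)
𝓘 : ℕ → ℕ → List (List ℕ)
𝓘 k j = filterᵇ (λ I → (length I ≡ᵇ k) ∧ twoSep I) (subsetsBelow (j ∸ 1))

R : ℕ → List ℕ → ℤ
R n I = foldr (λ i acc → ((+ n ℤ.- + i) ℤ.* + suc i) ℤ.* acc) (+ 1) I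

sumR : ℕ → ℕ → ℕ → ℤ
sumR n k j = foldr (λ I acc → R n I ℤ.+ acc) (+ 0) (𝓘 k j)

-- Clearing denominators, p_j = j! q_j has integer coefficients and satisfies
-- p_{M+2} = x p_{M+1} - (n - M)(M + 1) p_M. Hence the coefficient of x^(j-i) in p_j
-- vanishes for odd i, while for i = 2m its signed version (-1)^m [x^(j-2m)] p_j obeys
-- S(m+1, M+2) = S(m+1, M+1) + (n - M)(M + 1) S(m, M). This is also the recurrence of
-- S(m, j) = Σ_{I ∈ 𝓘(m,j)} R(I): a 2-separated subset of {0,…,M} either avoids M, or is a
-- 2-separated subset of {0,…,M-2} with M appended, which contributes the factor (n - M)(M + 1).
module Submission where

open import Defs
open import Data.Nat using (ℕ; zero; suc; _≤_; _<_; _*_; _+_; _∸_; _!; _<ᵇ_; _≡ᵇ_; NonZero; s≤s)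
open import Data.Nat.Properties
  using (_!≢0; m*n≢0; *-comm; +-suc; +-comm; +-identityʳ; ≤-reflexive; <⇒≤; m≤n⇒m≤1+n; n<1+n; <⇒<ᵇ;
         m+[n∸m]≡n)
open import Data.Integer as ℤ using (ℤ; +_; -[1+_]; -1ℤ)
import Data.Integer.Properties as ℤP
open import Data.Integer.Tactic.RingSolver using (solve-∀)
open import Data.Rational as ℚ using (ℚ; 0ℚ; 1ℚ; _/_; toℚᵘ)
import Data.Rational.Properties as ℚP
open import Data.Rational.Unnormalised as ℚᵘ using (mkℚᵘ) renaming (_≃_ to _≃ᵘ_; _/_ to _/ᵘ_)
import Data.Rational.Unnormalised.Properties as ℚᵘP
open import Data.Bool using (Bool; true; false; _∧_)
open import Data.Bool.Properties using (∧-assoc; ∧-identityʳ; ∧-zeroʳ; T-≡)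
open import Data.List using (List; []; _∷_; _++_; map; filterᵇ; length; foldr; [_]; _∷ʳ_)
open import Data.List.Properties using (filter-++; length-++; ++-identityʳ)
open import Data.Maybe using (nothing)
open import Data.Product using (_×_; _,_)
open import Function using (_∘_; Equivalence)
open import Relation.Nullary.Decidable using (T?)
open import Relation.Binary.PropositionalEquality
  using (_≡_; refl; sym; trans; cong; cong₂; subst; module ≡-Reasoning)
open import Tactic.RingSolver.Core.AlmostCommutativeRing using (AlmostCommutativeRing; fromCommutativeRing)
import Tactic.RingSolver as RingSolver

ℤ→ℚ : ℤ → ℚ
ℤ→ℚ z = z / 1

infixl 7 _/!_

_/!_ : ℤ → ℕ → ℚ
z /! j = _/_ z (j !) {{j !≢0}}

toℚᵘ-/ : ∀ z k .{{_ : NonZero k}} → toℚᵘ (z / k) ≃ᵘ z /ᵘ k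
toℚᵘ-/ z (suc k) = ℚP.toℚᵘ-fromℚᵘ (mkℚᵘ z k)

+-/ : ∀ z k w l .{{_ : NonZero k}} .{{_ : NonZero l}} →
      z / k ℚ.+ w / l ≡ _/_ (z ℤ.* + l ℤ.+ w ℤ.* + k) (k * l) {{m*n≢0 k l}}
+-/ z k@(suc _) w l@(suc _) = ℚP.toℚᵘ-injective (begin
  toℚᵘ (z / k ℚ.+ w / l)               ≈⟨ ℚP.toℚᵘ-homo-+ (z / k) (w / l) ⟩
  toℚᵘ (z / k) ℚᵘ.+ toℚᵘ (w / l)       ≈⟨ ℚᵘP.+-cong (toℚᵘ-/ z k) (toℚᵘ-/ w l) ⟩
  (z ℤ.* + l ℤ.+ w ℤ.* + k) /ᵘ (k * l) ≈⟨ toℚᵘ-/ _ (k * l) ⟨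
  toℚᵘ ((z ℤ.* + l ℤ.+ w ℤ.* + k) / (k * l)) ∎)
  where open ℚᵘP.≃-Reasoning

*-/ : ∀ z k w l .{{_ : NonZero k}} .{{_ : NonZero l}} →
      z / k ℚ.* (w / l) ≡ _/_ (z ℤ.* w) (k * l) {{m*n≢0 k l}}
*-/ z k@(suc _) w l@(suc _) = ℚP.toℚᵘ-injective (begin
  toℚᵘ (z / k ℚ.* (w / l))       ≈⟨ ℚP.toℚᵘ-homo-* (z / k) (w / l) ⟩
  toℚᵘ (z / k) ℚᵘ.* toℚᵘ (w / l) ≈⟨ ℚᵘP.*-cong (toℚᵘ-/ z k) (toℚᵘ-/ w l) ⟩
  (z ℤ.* w) /ᵘ (k * l)           ≈⟨ toℚᵘ-/ _ (k * l) ⟨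
  toℚᵘ ((z ℤ.* w) / (k * l))     ∎)
  where open ℚᵘP.≃-Reasoning

-‿/ : ∀ z k .{{_ : NonZero k}} → ℚ.- (z / k) ≡ (ℤ.- z) / k
-‿/ z k@(suc _) = ℚP.toℚᵘ-injective (begin
  toℚᵘ (ℚ.- (z / k)) ≈⟨ ℚP.toℚᵘ-homo‿- (z / k) ⟩
  ℚᵘ.- toℚᵘ (z / k)  ≈⟨ ℚᵘP.-‿cong (toℚᵘ-/ z k) ⟩
  (ℤ.- z) /ᵘ k       ≈⟨ toℚᵘ-/ (ℤ.- z) k ⟨
  toℚᵘ ((ℤ.- z) / k) ∎)
  where open ℚᵘP.≃-Reasoning

n/n≡1 : ∀ k .{{_ : NonZero k}} → + k / k ≡ 1ℚ
n/n≡1 (suc k) = ℚP.fromℚᵘ-cong {mkℚᵘ (+ suc k) k} {mkℚᵘ (+ 1) 0} (ℚᵘ.*≡* (ℤP.*-comm (+ suc k) (+ 1)))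

ℤ→ℚ-homo-+ : ∀ x y → ℤ→ℚ (x ℤ.+ y) ≡ ℤ→ℚ x ℚ.+ ℤ→ℚ y
ℤ→ℚ-homo-+ x y = sym (trans (+-/ x 1 y 1) (ℚP./-cong (cong₂ ℤ._+_ (ℤP.*-identityʳ x) (ℤP.*-identityʳ y)) refl))

ℤ→ℚ-homo-* : ∀ x y → ℤ→ℚ (x ℤ.* y) ≡ ℤ→ℚ x ℚ.* ℤ→ℚ y
ℤ→ℚ-homo-* x y = sym (*-/ x 1 y 1)

ℤ→ℚ-homo‿- : ∀ x → ℤ→ℚ (ℤ.- x) ≡ ℚ.- ℤ→ℚ x
ℤ→ℚ-homo‿- x = sym (-‿/ x 1)

ℤ→ℚ-homo-- : ∀ x y → ℤ→ℚ (x ℤ.- y) ≡ ℤ→ℚ x ℚ.- ℤ→ℚ y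
ℤ→ℚ-homo-- x y = trans (ℤ→ℚ-homo-+ x (ℤ.- y)) (cong (ℚ._+_ (ℤ→ℚ x)) (ℤ→ℚ-homo‿- y))

/-as-* : ∀ z k .{{_ : NonZero k}} → z / k ≡ ℤ→ℚ z ℚ.* (+ 1 / k)
/-as-* z k = sym (trans (*-/ z 1 (+ 1) k) (ℚP./-cong {{m*n≢0 1 k}} (ℤP.*-identityʳ z) (+-identityʳ k)))

ℤ→ℚ-*-1/ : ∀ k .{{_ : NonZero k}} → ℤ→ℚ (+ k) ℚ.* (+ 1 / k) ≡ 1ℚ
ℤ→ℚ-*-1/ k = trans (sym (/-as-* (+ k) k)) (n/n≡1 k)

/!-as-* : ∀ z j → z /! j ≡ ℤ→ℚ z ℚ.* (+ 1 /! j)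
/!-as-* z j = /-as-* z (j !) {{j !≢0}}

1/!-suc : ∀ k → + 1 /! suc k ≡ + 1 / suc k ℚ.* (+ 1 /! k)
1/!-suc k = sym (*-/ (+ 1) (suc k) (+ 1) (k !) {{_}} {{k !≢0}})

ℚ-ring : AlmostCommutativeRing _ _
ℚ-ring = fromCommutativeRing ℚP.+-*-commutativeRing (λ _ → nothing)

filterᵇ-map : ∀ {A B : Set} (p : B → Bool) (f : A → B) xs →
              filterᵇ p (map f xs) ≡ map f (filterᵇ (p ∘ f) xs)
filterᵇ-map p f []       = refl
filterᵇ-map p f (x ∷ xs) with p (f x)
... | true  = cong (f x ∷_) (filterᵇ-map p f xs)
... | false = filterᵇ-map p f xs

filterᵇ-cong : ∀ {A : Set} {p p′ : A → Bool} → (∀ x → p x ≡ p′ x) → ∀ xs → filterᵇ p xs ≡ filterᵇ p′ xs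
filterᵇ-cong             p≗p′ []       = refl
filterᵇ-cong {p = p} {p′} p≗p′ (x ∷ xs) with p x | p′ x | p≗p′ x
... | true  | true  | refl = cong (x ∷_) (filterᵇ-cong p≗p′ xs)
... | false | false | refl = filterᵇ-cong p≗p′ xs

filterᵇ-none : ∀ {A : Set} {p : A → Bool} → (∀ x → p x ≡ false) → ∀ xs → filterᵇ p xs ≡ []
filterᵇ-none             p≡false []       = refl
filterᵇ-none {p = p} p≡false (x ∷ xs) with p x | p≡false x
... | false | refl = filterᵇ-none p≡false xs

∑ : ∀ {A : Set} → (A → ℤ) → List A → ℤ
∑ f = foldr (λ x acc → f x ℤ.+ acc) (+ 0)

∑-++ : ∀ {A : Set} (f : A → ℤ) xs ys → ∑ f (xs ++ ys) ≡ ∑ f xs ℤ.+ ∑ f ys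
∑-++ f []       ys = sym (ℤP.+-identityˡ (∑ f ys))
∑-++ f (x ∷ xs) ys = trans (cong (ℤ._+_ (f x)) (∑-++ f xs ys)) (sym (ℤP.+-assoc (f x) _ _))

-- 2-separated subsets

fitsBefore : ℕ → List ℕ → Bool
fitsBefore c []          = true
fitsBefore c (x ∷ [])    = suc x <ᵇ c
fitsBefore c (_ ∷ y ∷ I) = fitsBefore c (y ∷ I)

fitsBefore-∷ʳ : ∀ c I a → fitsBefore c (I ∷ʳ a) ≡ (suc a <ᵇ c)
fitsBefore-∷ʳ c []          a = refl
fitsBefore-∷ʳ c (x ∷ [])    a = refl
fitsBefore-∷ʳ c (x ∷ y ∷ I) a = fitsBefore-∷ʳ c (y ∷ I) a

twoSep-∷ʳ : ∀ I a → twoSep (I ∷ʳ a) ≡ twoSep I ∧ fitsBefore a I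
twoSep-∷ʳ []          a = refl
twoSep-∷ʳ (x ∷ [])    a = ∧-identityʳ (suc x <ᵇ a)
twoSep-∷ʳ (x ∷ y ∷ I) a = trans (cong ((suc x <ᵇ y) ∧_) (twoSep-∷ʳ (y ∷ I) a)) (sym (∧-assoc (suc x <ᵇ y) _ _))

isSep : ℕ → List ℕ → Bool
isSep k I = (length I ≡ᵇ k) ∧ twoSep I

length-∷ʳ : ∀ {A : Set} (xs : List A) x → length (xs ∷ʳ x) ≡ suc (length xs)
length-∷ʳ xs x = trans (length-++ xs) (+-comm (length xs) 1)

isSep-∷ʳ : ∀ k I a → isSep (suc k) (I ∷ʳ a) ≡ isSep k I ∧ fitsBefore a I
isSep-∷ʳ k I a rewrite length-∷ʳ I a | twoSep-∷ʳ I a = sym (∧-assoc (length I ≡ᵇ k) (twoSep I) _)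

isSep-zero-∷ʳ : ∀ I a → isSep 0 (I ∷ʳ a) ≡ false
isSep-zero-∷ʳ I a rewrite length-∷ʳ I a = refl

filterᵇ-subsetsBelow-suc : ∀ (p : List ℕ → Bool) m →
  filterᵇ p (subsetsBelow (suc m)) ≡
  filterᵇ p (subsetsBelow m) ++ map (_∷ʳ m) (filterᵇ (p ∘ (_∷ʳ m)) (subsetsBelow m))
filterᵇ-subsetsBelow-suc p m = trans (filter-++ (T? ∘ p) (subsetsBelow m) _)
                                     (cong (filterᵇ p (subsetsBelow m) ++_) (filterᵇ-map p (_∷ʳ m) (subsetsBelow m)))

fitsBefore-subsetsBelow : ∀ (p : List ℕ → Bool) {m c} → m < c →
  filterᵇ (λ I → p I ∧ fitsBefore c I) (subsetsBelow m) ≡ filterᵇ p (subsetsBelow m)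
fitsBefore-subsetsBelow p {zero} _ with p []
... | true  = refl
... | false = refl
fitsBefore-subsetsBelow p {suc m} {c} m<c = begin
  filterᵇ p∧fits (subsetsBelow (suc m))
    ≡⟨ filterᵇ-subsetsBelow-suc p∧fits m ⟩
  filterᵇ p∧fits (subsetsBelow m) ++ map (_∷ʳ m) (filterᵇ (p∧fits ∘ (_∷ʳ m)) (subsetsBelow m))
    ≡⟨ cong₂ (λ xs ys → xs ++ map (_∷ʳ m) ys)
             (fitsBefore-subsetsBelow p (<⇒≤ m<c)) (filterᵇ-cong fits (subsetsBelow m)) ⟩
  filterᵇ p (subsetsBelow m) ++ map (_∷ʳ m) (filterᵇ (p ∘ (_∷ʳ m)) (subsetsBelow m))
    ≡⟨ filterᵇ-subsetsBelow-suc p m ⟨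
  filterᵇ p (subsetsBelow (suc m)) ∎
  where
  open ≡-Reasoning
  p∧fits : List ℕ → Bool
  p∧fits I = p I ∧ fitsBefore c I
  fits : ∀ I → p∧fits (I ∷ʳ m) ≡ p (I ∷ʳ m)
  fits I = trans (cong (p (I ∷ʳ m) ∧_) (trans (fitsBefore-∷ʳ c I m) (Equivalence.to T-≡ (<⇒<ᵇ m<c))))
                 (∧-identityʳ (p (I ∷ʳ m)))

fitsBefore-subsetsBelow-self : ∀ (p : List ℕ → Bool) m →
  filterᵇ (λ I → p I ∧ fitsBefore m I) (subsetsBelow m) ≡ filterᵇ p (subsetsBelow (m ∸ 1))
fitsBefore-subsetsBelow-self p zero with p []
... | true  = refl
... | false = refl
fitsBefore-subsetsBelow-self p (suc m) = begin
  filterᵇ p∧fits (subsetsBelow (suc m))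
    ≡⟨ filterᵇ-subsetsBelow-suc p∧fits m ⟩
  filterᵇ p∧fits (subsetsBelow m) ++ map (_∷ʳ m) (filterᵇ (p∧fits ∘ (_∷ʳ m)) (subsetsBelow m))
    ≡⟨ cong₂ (λ xs ys → xs ++ map (_∷ʳ m) ys)
             (fitsBefore-subsetsBelow p (n<1+n m)) (filterᵇ-none fails (subsetsBelow m)) ⟩
  filterᵇ p (subsetsBelow m) ++ []
    ≡⟨ ++-identityʳ _ ⟩
  filterᵇ p (subsetsBelow m) ∎
  where
  open ≡-Reasoning
  p∧fits : List ℕ → Bool
  p∧fits I = p I ∧ fitsBefore (suc m) I
  n<ᵇn : ∀ n → (n <ᵇ n) ≡ false
  n<ᵇn zero    = refl
  n<ᵇn (suc n) = n<ᵇn n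
  fails : ∀ I → p∧fits (I ∷ʳ m) ≡ false
  fails I rewrite fitsBefore-∷ʳ (suc m) I m | n<ᵇn m = ∧-zeroʳ (p (I ∷ʳ m))

𝓘-zero : ∀ j → 𝓘 0 j ≡ [ [] ]
𝓘-zero zero          = refl
𝓘-zero (suc zero)    = refl
𝓘-zero (suc (suc M)) = begin
  filterᵇ (isSep 0) (subsetsBelow (suc M))
    ≡⟨ filterᵇ-subsetsBelow-suc (isSep 0) M ⟩
  𝓘 0 (suc M) ++ map (_∷ʳ M) (filterᵇ (isSep 0 ∘ (_∷ʳ M)) (subsetsBelow M))
    ≡⟨ cong₂ (λ xs ys → xs ++ map (_∷ʳ M) ys)
             (𝓘-zero (suc M)) (filterᵇ-none (λ I → isSep-zero-∷ʳ I M) (subsetsBelow M)) ⟩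
  [ [] ] ∎
  where open ≡-Reasoning

𝓘-suc : ∀ k M → 𝓘 (suc k) (suc (suc M)) ≡ 𝓘 (suc k) (suc M) ++ map (_∷ʳ M) (𝓘 k M)
𝓘-suc k M = begin
  filterᵇ (isSep (suc k)) (subsetsBelow (suc M))
    ≡⟨ filterᵇ-subsetsBelow-suc (isSep (suc k)) M ⟩
  𝓘 (suc k) (suc M) ++ map (_∷ʳ M) (filterᵇ (isSep (suc k) ∘ (_∷ʳ M)) (subsetsBelow M))
    ≡⟨ cong (λ xs → 𝓘 (suc k) (suc M) ++ map (_∷ʳ M) xs) (begin
         filterᵇ (isSep (suc k) ∘ (_∷ʳ M)) (subsetsBelow M)
           ≡⟨ filterᵇ-cong (λ I → isSep-∷ʳ k I M) (subsetsBelow M) ⟩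
         filterᵇ (λ I → isSep k I ∧ fitsBefore M I) (subsetsBelow M)
           ≡⟨ fitsBefore-subsetsBelow-self (isSep k) M ⟩
         𝓘 k M ∎) ⟩
  𝓘 (suc k) (suc M) ++ map (_∷ʳ M) (𝓘 k M) ∎
  where open ≡-Reasoning

𝓘-empty : ∀ k j → j < k * 2 → 𝓘 k j ≡ []
𝓘-empty (suc k) zero          _ = refl
𝓘-empty (suc k) (suc zero)    _ = refl
𝓘-empty (suc k) (suc (suc M)) M+2<2k+2@(s≤s (s≤s M<2k)) = begin
  𝓘 (suc k) (suc (suc M))                   ≡⟨ 𝓘-suc k M ⟩
  𝓘 (suc k) (suc M) ++ map (_∷ʳ M) (𝓘 k M) ≡⟨ cong₂ (λ xs ys → xs ++ map (_∷ʳ M) ys)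
                                                      (𝓘-empty (suc k) (suc M) (<⇒≤ M+2<2k+2)) (𝓘-empty k M M<2k) ⟩
  []                                         ∎
  where open ≡-Reasoning

module _ (n : ℕ) where

  weight : ℕ → ℤ
  weight i = (+ n ℤ.- + i) ℤ.* + suc i

  R-∷ʳ : ∀ I a → R n (I ∷ʳ a) ≡ R n I ℤ.* weight a
  R-∷ʳ []      a = trans (ℤP.*-identityʳ (weight a)) (sym (ℤP.*-identityˡ (weight a)))
  R-∷ʳ (i ∷ I) a = trans (cong (weight i ℤ.*_) (R-∷ʳ I a)) (sym (ℤP.*-assoc (weight i) (R n I) (weight a)))

  ∑R-∷ʳ : ∀ a Is → ∑ (R n) (map (_∷ʳ a) Is) ≡ ∑ (R n) Is ℤ.* weight a
  ∑R-∷ʳ a []       = refl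
  ∑R-∷ʳ a (I ∷ Is) = trans (cong₂ ℤ._+_ (R-∷ʳ I a) (∑R-∷ʳ a Is)) (sym (ℤP.*-distribʳ-+ (weight a) (R n I) _))

  sumR-zero : ∀ j → sumR n 0 j ≡ + 1
  sumR-zero j = cong (∑ (R n)) (𝓘-zero j)

  sumR-suc : ∀ k M → sumR n (suc k) (suc (suc M)) ≡ sumR n (suc k) (suc M) ℤ.+ weight M ℤ.* sumR n k M
  sumR-suc k M = begin
    ∑ (R n) (𝓘 (suc k) (suc (suc M)))
      ≡⟨ cong (∑ (R n)) (𝓘-suc k M) ⟩
    ∑ (R n) (𝓘 (suc k) (suc M) ++ map (_∷ʳ M) (𝓘 k M))
      ≡⟨ ∑-++ (R n) (𝓘 (suc k) (suc M)) _ ⟩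
    sumR n (suc k) (suc M) ℤ.+ ∑ (R n) (map (_∷ʳ M) (𝓘 k M))
      ≡⟨ cong (ℤ._+_ (sumR n (suc k) (suc M))) (trans (∑R-∷ʳ M (𝓘 k M)) (ℤP.*-comm (sumR n k M) (weight M))) ⟩
    sumR n (suc k) (suc M) ℤ.+ weight M ℤ.* sumR n k M ∎
    where open ≡-Reasoning

  sumR-empty : ∀ {k j} → j < k * 2 → sumR n k j ≡ + 0
  sumR-empty {k} {j} j<2k = cong (∑ (R n)) (𝓘-empty k j j<2k)

-- The integer polynomials j! q_j

mulXℤ : (ℕ → ℤ) → ℕ → ℤ
mulXℤ p zero    = + 0
mulXℤ p (suc d) = p d

module _ (n : ℕ) where

  q! : ℕ → ℕ → ℤ
  q! zero          zero          = + 1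
  q! zero          (suc _)       = + 0
  q! (suc zero)    zero          = + 0
  q! (suc zero)    (suc zero)    = + 1
  q! (suc zero)    (suc (suc _)) = + 0
  q! (suc (suc M)) d             = mulXℤ (q! (suc M)) d ℤ.- weight n M ℤ.* q! M d

  q!-shift : ∀ M d → q! M d ≡ + 0 → q! (suc (suc M)) d ≡ mulXℤ (q! (suc M)) d
  q!-shift M d q!≡0 = begin
    x ℤ.- weight n M ℤ.* q! M d ≡⟨ cong (λ y → x ℤ.- weight n M ℤ.* y) q!≡0 ⟩
    x ℤ.- weight n M ℤ.* + 0    ≡⟨ cong (ℤ._-_ x) (ℤP.*-zeroʳ (weight n M)) ⟩
    x ℤ.- + 0                   ≡⟨ ℤP.+-identityʳ x ⟩
    x                           ∎
    where
    open ≡-Reasoning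
    x = mulXℤ (q! (suc M)) d

  q!-degree : ∀ j d → j < d → q! j d ≡ + 0
  q!-degree zero          (suc d)       _           = refl
  q!-degree (suc zero)    (suc (suc d)) _           = refl
  q!-degree (suc zero)    (suc zero)    (s≤s ())
  q!-degree (suc (suc M)) (suc d)       (s≤s M+1<d) =
    trans (q!-shift M (suc d) (q!-degree M (suc d) (m≤n⇒m≤1+n (<⇒≤ M+1<d)))) (q!-degree (suc M) d M+1<d)

  q!-leading : ∀ d → q! d d ≡ + 1
  q!-leading zero          = refl
  q!-leading (suc zero)    = refl
  q!-leading (suc (suc M)) =
    trans (q!-shift M (suc (suc M)) (q!-degree M (suc (suc M)) (m≤n⇒m≤1+n (n<1+n M)))) (q!-leading (suc M))

  -- Indices are written m * 2 rather than 2 * m because suc m * 2 reduces to suc (suc (m * 2)).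
  q!-odd : ∀ m d → q! (suc (m * 2) + d) d ≡ + 0
  q!-odd zero    zero    = refl
  q!-odd zero    (suc d) = trans (q!-shift d (suc d) (q!-degree d (suc d) (n<1+n d))) (q!-odd zero d)
  q!-odd (suc m) zero    = q!-shift (suc (m * 2 + 0)) 0 (q!-odd m 0)
  q!-odd (suc m) (suc d) =
    trans (q!-shift (suc (m * 2 + suc d)) (suc d) (q!-odd m (suc d)))
          (subst (λ t → q! (suc (suc t)) d ≡ + 0) (sym (+-suc (m * 2) d)) (q!-odd (suc m) d))

  q!-even-step : ∀ m M d →
    mulXℤ (q! (suc M)) d ≡ -1ℤ ℤ.^ suc m ℤ.* sumR n (suc m) (suc M) →
    q! M d ≡ -1ℤ ℤ.^ m ℤ.* sumR n m M →
    q! (suc (suc M)) d ≡ -1ℤ ℤ.^ suc m ℤ.* sumR n (suc m) (suc (suc M))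
  q!-even-step m M d shifted lower = begin
    mulXℤ (q! (suc M)) d ℤ.- weight n M ℤ.* q! M d ≡⟨ cong₂ (λ x y → x ℤ.- weight n M ℤ.* y) shifted lower ⟩
    -1ℤ ℤ.* s ℤ.* A ℤ.- weight n M ℤ.* (s ℤ.* B)   ≡⟨ sign-flip s A B (weight n M) ⟩
    -1ℤ ℤ.* s ℤ.* (A ℤ.+ weight n M ℤ.* B)         ≡⟨ cong (-1ℤ ℤ.* s ℤ.*_) (sumR-suc n m M) ⟨
    -1ℤ ℤ.* s ℤ.* sumR n (suc m) (suc (suc M))     ∎
    where
    open ≡-Reasoning
    s = -1ℤ ℤ.^ m
    A = sumR n (suc m) (suc M)
    B = sumR n m M
    sign-flip : ∀ s a b w → -1ℤ ℤ.* s ℤ.* a ℤ.- w ℤ.* (s ℤ.* b) ≡ -1ℤ ℤ.* s ℤ.* (a ℤ.+ w ℤ.* b)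
    sign-flip = solve-∀

  q!-even : ∀ m d → q! (m * 2 + d) d ≡ -1ℤ ℤ.^ m ℤ.* sumR n m (m * 2 + d)
  q!-even zero    d       = trans (q!-leading d) (sym (trans (ℤP.*-identityˡ _) (sumR-zero n d)))
  q!-even (suc m) zero    = q!-even-step m (m * 2 + 0) 0 no-room (q!-even m 0)
    where
    no-room : + 0 ≡ -1ℤ ℤ.^ suc m ℤ.* sumR n (suc m) (suc (m * 2 + 0))
    no-room = sym (trans (cong (-1ℤ ℤ.^ suc m ℤ.*_) (sumR-empty n (s≤s (s≤s (≤-reflexive (+-identityʳ (m * 2)))))))
                         (ℤP.*-zeroʳ (-1ℤ ℤ.^ suc m)))
  q!-even (suc m) (suc d) = q!-even-step m (m * 2 + suc d) (suc d)
    (subst (λ t → q! (suc t) d ≡ -1ℤ ℤ.^ suc m ℤ.* sumR n (suc m) (suc t))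
           (sym (+-suc (m * 2) d)) (q!-even (suc m) d))
    (q!-even m (suc d))

  ℤ→ℚ-weight : ∀ M → ℤ→ℚ (weight n M) ≡ (ℕ→ℚ n ℚ.- ℕ→ℚ M) ℚ.* ℤ→ℚ (+ suc M)
  ℤ→ℚ-weight M =
    trans (ℤ→ℚ-homo-* (+ n ℤ.- + M) (+ suc M)) (cong (ℚ._* ℤ→ℚ (+ suc M)) (ℤ→ℚ-homo-- (+ n) (+ M)))

  /!-recurrence : ∀ M a b →
    + 1 / suc (suc M) ℚ.* (a /! suc M ℚ.+ ℚ.- (ℕ→ℚ n ℚ.- ℕ→ℚ M) ℚ.* (b /! M)) ≡
    (a ℤ.- weight n M ℤ.* b) /! suc (suc M)
  /!-recurrence M a b = sym (begin
    (a ℤ.- weight n M ℤ.* b) /! suc (suc M)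
      ≡⟨ /!-as-* (a ℤ.- weight n M ℤ.* b) (suc (suc M)) ⟩
    ℤ→ℚ (a ℤ.- weight n M ℤ.* b) ℚ.* (+ 1 /! suc (suc M))
      ≡⟨ cong₂ ℚ._*_ numerator (trans (1/!-suc (suc M)) (cong (u ℚ.*_) (1/!-suc M))) ⟩
    (A ℚ.- D ℚ.* S ℚ.* B) ℚ.* (u ℚ.* (e ℚ.* v))
      ≡⟨ regroup u e v A B D S ⟩
    u ℚ.* (A ℚ.* (e ℚ.* v) ℚ.+ ℚ.- D ℚ.* (B ℚ.* v) ℚ.* (S ℚ.* e))
      ≡⟨ cong (λ x → u ℚ.* (A ℚ.* (e ℚ.* v) ℚ.+ ℚ.- D ℚ.* (B ℚ.* v) ℚ.* x)) (ℤ→ℚ-*-1/ (suc M)) ⟩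
    u ℚ.* (A ℚ.* (e ℚ.* v) ℚ.+ ℚ.- D ℚ.* (B ℚ.* v) ℚ.* 1ℚ)
      ≡⟨ cong₂ (λ x y → u ℚ.* (x ℚ.+ y)) (cong (A ℚ.*_) (sym (1/!-suc M))) (ℚP.*-identityʳ _) ⟩
    u ℚ.* (A ℚ.* (+ 1 /! suc M) ℚ.+ ℚ.- D ℚ.* (B ℚ.* v))
      ≡⟨ cong₂ (λ x y → u ℚ.* (x ℚ.+ ℚ.- D ℚ.* y)) (sym (/!-as-* a (suc M))) (sym (/!-as-* b M)) ⟩
    u ℚ.* (a /! suc M ℚ.+ ℚ.- D ℚ.* (b /! M)) ∎)
    where
    open ≡-Reasoning
    u = + 1 / suc (suc M)
    e = + 1 / suc M
    v = + 1 /! M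
    A = ℤ→ℚ a
    B = ℤ→ℚ b
    D = ℕ→ℚ n ℚ.- ℕ→ℚ M
    S = ℤ→ℚ (+ suc M)
    regroup : ∀ u e v A B D S →
      (A ℚ.- D ℚ.* S ℚ.* B) ℚ.* (u ℚ.* (e ℚ.* v)) ≡
      u ℚ.* (A ℚ.* (e ℚ.* v) ℚ.+ ℚ.- D ℚ.* (B ℚ.* v) ℚ.* (S ℚ.* e))
    regroup = RingSolver.solve-∀ ℚ-ring
    numerator : ℤ→ℚ (a ℤ.- weight n M ℤ.* b) ≡ A ℚ.- D ℚ.* S ℚ.* B
    numerator = begin
      ℤ→ℚ (a ℤ.- weight n M ℤ.* b) ≡⟨ ℤ→ℚ-homo-- a _ ⟩
      A ℚ.- ℤ→ℚ (weight n M ℤ.* b) ≡⟨ cong (ℚ._-_ A) (ℤ→ℚ-homo-* (weight n M) b) ⟩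
      A ℚ.- ℤ→ℚ (weight n M) ℚ.* B ≡⟨ cong (λ x → A ℚ.- x ℚ.* B) (ℤ→ℚ-weight M) ⟩
      A ℚ.- D ℚ.* S ℚ.* B          ∎

  q≡q!/! : ∀ j d → q n j d ≡ q! j d /! j
  q≡q!/! zero          zero          = refl
  q≡q!/! zero          (suc d)       = refl
  q≡q!/! (suc zero)    zero          = refl
  q≡q!/! (suc zero)    (suc zero)    = refl
  q≡q!/! (suc zero)    (suc (suc d)) = refl
  q≡q!/! (suc (suc M)) d             = begin
    + 1 / suc (suc M) ℚ.* (mulX (q n (suc M)) d ℚ.+ c ℚ.* q n M d)
      ≡⟨ cong₂ (λ x y → + 1 / suc (suc M) ℚ.* (x ℚ.+ c ℚ.* y)) (mulX-q d) (q≡q!/! M d) ⟩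
    + 1 / suc (suc M) ℚ.* (mulXℤ (q! (suc M)) d /! suc M ℚ.+ c ℚ.* (q! M d /! M))
      ≡⟨ /!-recurrence M (mulXℤ (q! (suc M)) d) (q! M d) ⟩
    q! (suc (suc M)) d /! suc (suc M) ∎
    where
    open ≡-Reasoning
    c = ℚ.- (ℕ→ℚ n ℚ.- ℕ→ℚ M)
    mulX-q : ∀ d → mulX (q n (suc M)) d ≡ mulXℤ (q! (suc M)) d /! suc M
    mulX-q zero    = sym (ℚP.0/n≡0 (suc M !) {{suc M !≢0}})
    mulX-q (suc d) = q≡q!/! (suc M) d

L≡q!/! : ∀ n i j → i ≤ j → L n i j ≡ q! n (i + (j ∸ i)) (j ∸ i) /! j
L≡q!/! n i j i≤j = trans (q≡q!/! n j (j ∸ i)) (cong (λ j′ → q! n j′ (j ∸ i) /! j) (sym (m+[n∸m]≡n i≤j)))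

theorem1 : (n : ℕ) → 1 ≤ n → (j : ℕ) → j ≤ n → (i : ℕ) → i ≤ j →
    ((m : ℕ) → i ≡ 2 * m + 1 → L n i j ≡ 0ℚ) ×
    ((m : ℕ) → i ≡ 2 * m →
      L n i j ≡ _/_ ((-[1+ 0 ] ℤ.^ m) ℤ.* sumR n m j) (j !) {{j !≢0}})
theorem1 n _ j _ i i≤j = odd , even
  where
  open ≡-Reasoning
  d = j ∸ i
  odd : (m : ℕ) → i ≡ 2 * m + 1 → L n i j ≡ 0ℚ
  odd m i≡2m+1 = begin
    L n i j                       ≡⟨ L≡q!/! n i j i≤j ⟩
    q! n (i + d) d /! j           ≡⟨ cong (λ t → q! n (t + d) d /! j) i≡1+m*2 ⟩
    q! n (suc (m * 2) + d) d /! j ≡⟨ cong (_/! j) (q!-odd n m d) ⟩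
    + 0 /! j                      ≡⟨ ℚP.0/n≡0 (j !) {{j !≢0}} ⟩
    0ℚ                            ∎
    where
    i≡1+m*2 : i ≡ suc (m * 2)
    i≡1+m*2 = trans i≡2m+1 (trans (+-comm (2 * m) 1) (cong suc (*-comm 2 m)))
  even : (m : ℕ) → i ≡ 2 * m → L n i j ≡ (-1ℤ ℤ.^ m ℤ.* sumR n m j) /! j
  even m i≡2m = begin
    L n i j                                    ≡⟨ L≡q!/! n i j i≤j ⟩
    q! n (i + d) d /! j                        ≡⟨ cong (λ t → q! n (t + d) d /! j) i≡m*2 ⟩
    q! n (m * 2 + d) d /! j                    ≡⟨ cong (_/! j) (q!-even n m d) ⟩
    (-1ℤ ℤ.^ m ℤ.* sumR n m (m * 2 + d)) /! j ≡⟨ cong (λ t → (-1ℤ ℤ.^ m ℤ.* sumR n m t) /! j) m*2+d≡j ⟩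
    (-1ℤ ℤ.^ m ℤ.* sumR n m j) /! j            ∎
    where
    i≡m*2 : i ≡ m * 2
    i≡m*2 = trans i≡2m (*-comm 2 m)
    m*2+d≡j : m * 2 + d ≡ j
    m*2+d≡j = trans (cong (_+ d) (sym i≡m*2)) (m+[n∸m]≡n i≤j)
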